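{- Let $p\ge5$ be a prime and $\mathsf{A}=\prod_{i=1}^r\mathsf{A}_i$ a finite product of local commutative $\mathbb{F}_p$-algebras. Then the normal closure of $\mathrm{SL}_2(\mathbb{F}_p)$ in $\mathrm{SL}_2(\mathsf{A})$ is $\mathrm{SL}_2(\mathsf{A})$.
   Context: $\mathrm{SL}_2(\mathbb{F}_p)$ is viewed as a subgroup of $\mathrm{SL}_2(\mathsf{A})$ via $\mathbb{F}_p\subseteq\mathsf{A}$. -}

module Defs where

open import Level using (Level; _⊔_)
open import Data.Nat using (ℕ; zero; suc) renaming (_*_ to _*ℕ_; _+_ to _+ℕ_)
open import Data.Nat.DivMod using (_%_)
open import Data.Fin using (Fin; toℕ)
open import Data.Product using (Σ; _×_)
open import Data.Integer using (+_) renaming (_-_ to _-ℤ_)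
open import Data.Integer.Divisibility renaming (_∣_ to _∣ℤ_)
open import Data.Sum using (_⊎_)
open import Relation.Binary.PropositionalEquality using (_≡_)
open import Relation.Nullary using (¬_)
open import Algebra.Bundles using (CommutativeRing)
open import Algebra.Bundles.Raw using (RawRing)

private variable u ℓ : Level

module _ (R : RawRing u ℓ) where
  open RawRing R

  Invertible : Carrier → Set (u ⊔ ℓ)
  Invertible x = Σ Carrier (λ y → x * y ≈ 1#)

  fromℕ : ℕ → Carrier
  fromℕ zero    = 0#
  fromℕ (suc n) = 1# + fromℕ n

  record Mat2 : Set u where
    constructor mat
    field
      a b c′ d : Carrier

  open Mat2 public

  _≈M_ : Mat2 → Mat2 → Set ℓ
  M ≈M N = (a M ≈ a N × b M ≈ b N) × (c′ M ≈ c′ N × d M ≈ d N)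

  _*M_ : Mat2 → Mat2 → Mat2
  M *M N = mat (a M * a N + b M * c′ N) (a M * b N + b M * d N)
               (c′ M * a N + d M * c′ N) (c′ M * b N + d M * d N)

  idM : Mat2
  idM = mat 1# 0# 0# 1#

  det : Mat2 → Carrier
  det M = a M * d M + - (b M * c′ M)

  -- adjugate; for M with det M ≈ 1 this is the inverse of M
  adj : Mat2 → Mat2
  adj M = mat (d M) (- b M) (- c′ M) (a M)

  InSL2 : Mat2 → Set ℓ
  InSL2 M = det M ≈ 1#

-- SL₂(𝔽_p): matrices with entries in 𝔽_p = Fin p (residues 0..p-1),
-- with determinant ≡ 1 (mod p), i.e. p divides a·d - b·c - 1 in ℤ.

record SL2Fp (p : ℕ) : Set where
  constructor mkSL2Fp
  field
    a b c d : Fin p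
    detOne  : (+ p) ∣ℤ ((+ (toℕ a *ℕ toℕ d)) -ℤ (+ (1 +ℕ toℕ b *ℕ toℕ c)))

module _ (R : RawRing u ℓ) (p : ℕ) where
  open RawRing R

  ι : SL2Fp p → Mat2 R
  ι g = mat (fromℕ R (toℕ (SL2Fp.a g))) (fromℕ R (toℕ (SL2Fp.b g)))
            (fromℕ R (toℕ (SL2Fp.c g))) (fromℕ R (toℕ (SL2Fp.d g)))

  data NormalClosure : Mat2 R → Set (u ⊔ ℓ) where
    conj : (h : Mat2 R) → InSL2 R h → (k : SL2Fp p) →
           NormalClosure (_*M_ R (_*M_ R h (ι k)) (adj R h))
    one  : NormalClosure (idM R)
    mul  : ∀ {M N} → NormalClosure M → NormalClosure N → NormalClosure (_*M_ R M N)
    inv  : ∀ {M} → NormalClosure M → NormalClosure (adj R M)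
    resp : ∀ {M N} → _≈M_ R M N → NormalClosure M → NormalClosure N

-- Local commutative rings (constructive definition: 1 ≠ 0, and if a sum
-- is a unit then one of the summands is a unit).

IsLocal : CommutativeRing u ℓ → Set (u ⊔ ℓ)
IsLocal A = ¬ (1# ≈ 0#) × (∀ x y → Invertible rawRing (x + y) → Invertible rawRing x ⊎ Invertible rawRing y)
  where open CommutativeRing A

-- A commutative ring is an 𝔽_p-algebra (p prime) iff p · 1 = 0 in it.
IsFpAlgebra : ℕ → CommutativeRing u ℓ → Set ℓ
IsFpAlgebra p A = fromℕ rawRing p ≈ 0#
  where open CommutativeRing A

∏ : (r : ℕ) → (Fin r → CommutativeRing u ℓ) → RawRing u ℓ
∏ r A = record
  { Carrier = (i : Fin r) → CommutativeRing.Carrier (A i)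
  ; _≈_ = λ x y → ∀ i → CommutativeRing._≈_ (A i) (x i) (y i)
  ; _+_ = λ x y i → CommutativeRing._+_ (A i) (x i) (y i)
  ; _*_ = λ x y i → CommutativeRing._*_ (A i) (x i) (y i)
  ; -_  = λ x i → CommutativeRing.-_ (A i) (x i)
  ; 0#  = λ i → CommutativeRing.0# (A i)
  ; 1#  = λ i → CommutativeRing.1# (A i)
  }

-- Over a ring of stable range one every matrix of SL₂ is a product of elementary
-- matrices: for (a b ; c d) there is y with a y + b a unit, so right multiplication
-- by E₁₂(y) E₂₁(x) for a suitable x puts a 1 in the top-left corner, and such a
-- matrix factors as E₂₁(c) E₁₂(b). Local rings have stable range one,
-- and the condition passes to finite products. Finally every elementary matrix is
-- a commutator with d = diag(2, 1/2) ∈ SL₂(𝔽_p), since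
-- E₁₂(-u) d E₁₂(u) d⁻¹ = E₁₂(3u) and 3 is invertible for p ≥ 5.
module Submission where

open import Defs
open import Level using (Level; _⊔_)
open import Algebra.Bundles using (CommutativeRing; RawRing)
import Algebra.Solver.Ring
open import Algebra.Solver.Ring.AlmostCommutativeRing
  using (fromCommutativeRing; _-Raw-AlmostCommutative⟶_)
open import Data.Fin using (Fin; toℕ; fromℕ<)
open import Data.Fin.Patterns using (0F; 1F; 2F; 3F; 4F; 5F; 6F; 7F)
open import Data.Fin.Properties using (toℕ-fromℕ<)
import Data.Integer as ℤ
import Data.Integer.Properties as ℤ
open import Data.Integer.Divisibility using () renaming (_∣_ to _∣ℤ_)
import Data.Maybe as Maybe
open import Data.Nat as ℕ using (ℕ; zero; suc; _≤_)
import Data.Nat.Properties as ℕ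
open import Data.Nat.Divisibility using (∣-refl)
open import Data.Nat.Primality using (Prime)
open import Data.Product using (_,_; Σ-syntax; proj₁; proj₂)
open import Data.Sum using (inj₁; inj₂)
open import Data.Vec using (Vec; []; _∷_)
open import Function using (_∘_)
open import Relation.Binary.Consequences using (dec⇒weaklyDec)
open import Relation.Binary.PropositionalEquality as ≡ using (_≡_)

private variable c ℓ : Level

module _ {p} (pr : Prime p) where
  open import Data.Nat
  open import Data.Nat.Properties
  open import Data.Nat.DivMod using (_%_; _/_; m≡m%n+[m/n]*n; m%n<n)
  open import Data.Nat.Divisibility using (_∣_; divides)
  open import Data.Nat.Divisibility.Core using (hasNonTrivialDivisor)
  open import Data.Nat.Primality using (prime⇒¬composite)
  open import Data.Nat.Tactic.RingSolver using (solve-∀)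
  open import Relation.Binary.PropositionalEquality
  open import Relation.Nullary using (¬_; contradiction)

  prime⇒∤ : ∀ {d} → 1 < d → d < p → ¬ d ∣ p
  prime⇒∤ 1<d d<p d∣p = prime⇒¬composite pr (hasNonTrivialDivisor {{n>1⇒nonTrivial 1<d}} d<p d∣p)

  2⁻¹-mod-prime : 2 < p → Σ[ t ∈ Fin p ] 2 * toℕ t ≡ suc p
  2⁻¹-mod-prime 2<p with p % 2 | m≡m%n+[m/n]*n p 2 | m%n<n p 2
  ... | 0           | p≡h*2   | _ = contradiction (divides (p / 2) p≡h*2) (prime⇒∤ ≤-refl 2<p)
  ... | suc (suc _) | _       | s≤s (s≤s ())
  ... | 1           | p≡1+h*2 | _ = fromℕ< t<p , trans (cong (2 *_) (toℕ-fromℕ< t<p)) 2t≡1+p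
    where
    t = suc (p / 2)
    2t≡1+p : 2 * t ≡ suc p
    2t≡1+p = trans (lemma (p / 2)) (cong suc (sym p≡1+h*2))
      where lemma : ∀ h → 2 * suc h ≡ suc (1 + h * 2)
            lemma = solve-∀
    t<p : t < p
    t<p = *-cancelˡ-< 2 t p (begin-strict
      2 * t   ≡⟨ 2t≡1+p ⟩
      1 + p   <⟨ +-monoˡ-< p (<-trans (s≤s (s≤s z≤n)) 2<p) ⟩
      p + p   ≡⟨ cong (_+_ p) (+-identityʳ p) ⟨
      2 * p   ∎)
      where open ≤-Reasoning

  3⁻¹-mod-prime : 3 < p → Σ[ k ∈ ℕ ] Σ[ j ∈ ℕ ] 3 * k ≡ suc (j * p)
  3⁻¹-mod-prime 3<p with p % 3 | m≡m%n+[m/n]*n p 3 | m%n<n p 3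
  ... | 0 | p≡h*3   | _ = contradiction (divides (p / 3) p≡h*3) (prime⇒∤ (s≤s (s≤s z≤n)) 3<p)
  ... | 1 | p≡1+h*3 | _ = suc (2 * h) , 2 , trans (lemma h) (cong (λ q → suc (2 * q)) (sym p≡1+h*3))
    where h = p / 3
          lemma : ∀ h → 3 * suc (2 * h) ≡ suc (2 * (1 + h * 3))
          lemma = solve-∀
  ... | 2 | p≡2+h*3 | _ = suc h , 1 , trans (lemma h) (cong (λ q → suc (1 * q)) (sym p≡2+h*3))
    where h = p / 3
          lemma : ∀ h → 3 * suc h ≡ suc (1 * (2 + h * 3))
          lemma = solve-∀
  ... | suc (suc (suc _)) | _ | s≤s (s≤s (s≤s ()))

-- The library's ring solver needs a coefficient ring mapping into R; we use ℤ.
-- The optimised multiple _×_ makes ⟦ 0 ⟧ℤ and ⟦ 1 ⟧ℤ reduce to 0# and 1#, so the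
-- solver's constants match the ring's own.
module IntegerImage (R : CommutativeRing c ℓ) where
  open CommutativeRing R
  open import Algebra.Properties.Ring ring using (-‿involutive; -0#≈0#; -‿distribˡ-*)
  open import Algebra.Properties.AbelianGroup +-abelianGroup using (⁻¹-∙-comm)
  open import Algebra.Properties.Monoid.Mult.TCOptimised +-monoid using (_×_; 1+×; ×-homo-+)
  open import Relation.Binary.Reasoning.Setoid setoid
  open import Data.Integer using (ℤ; +_; -[1+_]; _⊖_)

  ⟦_⟧ℤ : ℤ → Carrier
  ⟦ + n      ⟧ℤ = n × 1#
  ⟦ -[1+ n ] ⟧ℤ = - (suc n × 1#)

  ⟦⊖⟧ : ∀ m n → ⟦ m ⊖ n ⟧ℤ ≈ m × 1# - n × 1#
  ⟦⊖⟧ m zero = begin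
    ⟦ m ⊖ 0 ⟧ℤ   ≡⟨ ≡.cong ⟦_⟧ℤ (ℤ.⊖-≥ {m} ℕ.z≤n) ⟩
    m × 1#       ≈⟨ +-identityʳ _ ⟨
    m × 1# + 0#  ≈⟨ +-congˡ -0#≈0# ⟨
    m × 1# - 0#  ∎
  ⟦⊖⟧ zero (suc n) = sym (+-identityˡ _)
  ⟦⊖⟧ (suc m) (suc n) = begin
    ⟦ suc m ⊖ suc n ⟧ℤ       ≡⟨ ≡.cong ⟦_⟧ℤ (ℤ.[1+m]⊖[1+n]≡m⊖n m n) ⟩
    ⟦ m ⊖ n ⟧ℤ               ≈⟨ ⟦⊖⟧ m n ⟩
    x - y                    ≈⟨ +-congʳ (+-identityˡ x) ⟨
    (0# + x) - y             ≈⟨ +-congʳ (+-congʳ (-‿inverseʳ 1#)) ⟨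
    ((1# - 1#) + x) - y      ≈⟨ +-congʳ (+-assoc 1# (- 1#) x) ⟩
    (1# + (- 1# + x)) - y    ≈⟨ +-congʳ (+-congˡ (+-comm (- 1#) x)) ⟩
    (1# + (x - 1#)) - y      ≈⟨ +-congʳ (+-assoc 1# x (- 1#)) ⟨
    ((1# + x) - 1#) - y      ≈⟨ +-assoc (1# + x) (- 1#) (- y) ⟩
    (1# + x) + (- 1# - y)    ≈⟨ +-congˡ (⁻¹-∙-comm 1# y) ⟩
    (1# + x) - (1# + y)      ≈⟨ +-cong (1+× m 1#) (-‿cong (1+× n 1#)) ⟨
    suc m × 1# - suc n × 1#  ∎
    where x = m × 1#; y = n × 1#

  ⟦+⟧ : ∀ i j → ⟦ i ℤ.+ j ⟧ℤ ≈ ⟦ i ⟧ℤ + ⟦ j ⟧ℤ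
  ⟦+⟧ (+ m)    (+ n)    = ×-homo-+ 1# m n
  ⟦+⟧ (+ m)    -[1+ n ] = ⟦⊖⟧ m (suc n)
  ⟦+⟧ -[1+ m ] (+ n)    = trans (⟦⊖⟧ n (suc m)) (+-comm _ _)
  ⟦+⟧ -[1+ m ] -[1+ n ] = begin
    - (suc (suc (m ℕ.+ n)) × 1#)     ≡⟨ ≡.cong (λ k → - (suc k × 1#)) (ℕ.+-suc m n) ⟨
    - ((suc m ℕ.+ suc n) × 1#)       ≈⟨ -‿cong (×-homo-+ 1# (suc m) (suc n)) ⟩
    - (suc m × 1# + suc n × 1#)      ≈⟨ ⁻¹-∙-comm _ _ ⟨
    - (suc m × 1#) + - (suc n × 1#)  ∎

  ⟦-⟧ : ∀ i → ⟦ ℤ.- i ⟧ℤ ≈ - ⟦ i ⟧ℤ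
  ⟦-⟧ (+ zero)  = sym -0#≈0#
  ⟦-⟧ (+ suc n) = refl
  ⟦-⟧ -[1+ n ]  = sym (-‿involutive _)

  ⟦+*⟧ : ∀ m j → ⟦ + m ℤ.* j ⟧ℤ ≈ ⟦ + m ⟧ℤ * ⟦ j ⟧ℤ
  ⟦+*⟧ zero    j = sym (zeroˡ _)
  ⟦+*⟧ (suc m) j = begin
    ⟦ + suc m ℤ.* j ⟧ℤ              ≡⟨ ≡.cong ⟦_⟧ℤ (ℤ.suc-* (+ m) j) ⟩
    ⟦ j ℤ.+ + m ℤ.* j ⟧ℤ            ≈⟨ ⟦+⟧ j (+ m ℤ.* j) ⟩
    ⟦ j ⟧ℤ + ⟦ + m ℤ.* j ⟧ℤ         ≈⟨ +-cong (sym (*-identityˡ _)) (⟦+*⟧ m j) ⟩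
    1# * ⟦ j ⟧ℤ + m × 1# * ⟦ j ⟧ℤ  ≈⟨ distribʳ _ _ _ ⟨
    (1# + m × 1#) * ⟦ j ⟧ℤ         ≈⟨ *-congʳ (1+× m 1#) ⟨
    suc m × 1# * ⟦ j ⟧ℤ            ∎

  ⟦*⟧ : ∀ i j → ⟦ i ℤ.* j ⟧ℤ ≈ ⟦ i ⟧ℤ * ⟦ j ⟧ℤ
  ⟦*⟧ (+ m)    j = ⟦+*⟧ m j
  ⟦*⟧ -[1+ m ] j = begin
    ⟦ -[1+ m ] ℤ.* j ⟧ℤ       ≡⟨ ≡.cong ⟦_⟧ℤ (ℤ.neg-distribˡ-* (+ suc m) j) ⟨
    ⟦ ℤ.- (+ suc m ℤ.* j) ⟧ℤ  ≈⟨ ⟦-⟧ (+ suc m ℤ.* j) ⟩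
    - ⟦ + suc m ℤ.* j ⟧ℤ      ≈⟨ -‿cong (⟦+*⟧ (suc m) j) ⟩
    - (suc m × 1# * ⟦ j ⟧ℤ)   ≈⟨ -‿distribˡ-* _ _ ⟩
    - (suc m × 1#) * ⟦ j ⟧ℤ   ∎

  ℤ-homomorphism : ℤ.+-*-rawRing -Raw-AlmostCommutative⟶ fromCommutativeRing R
  ℤ-homomorphism = record
    { ⟦_⟧ = ⟦_⟧ℤ ; +-homo = ⟦+⟧ ; *-homo = ⟦*⟧ ; -‿homo = ⟦-⟧ ; 0-homo = refl ; 1-homo = refl }

module RingSolver (R : CommutativeRing c ℓ) where
  open CommutativeRing R
  open IntegerImage R

  open Algebra.Solver.Ring ℤ.+-*-rawRing (fromCommutativeRing R) ℤ-homomorphism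
    (λ i j → Maybe.map (reflexive ∘ ≡.cong ⟦_⟧ℤ) (dec⇒weaklyDec ℤ._≟_ i j)) public

  :0 :1 : ∀ {n} → Polynomial n
  :0 = con ℤ.0ℤ
  :1 = con ℤ.1ℤ

module _ (R : CommutativeRing c ℓ) where
  open CommutativeRing R
  open import Algebra.Properties.Semiring.Mult semiring using (_×_; ×1-homo-*)
  open import Relation.Binary.Reasoning.Setoid setoid

  fromℕ≡×1 : ∀ n → fromℕ rawRing n ≡ n × 1#
  fromℕ≡×1 zero    = ≡.refl
  fromℕ≡×1 (suc n) = ≡.cong (_+_ 1#) (fromℕ≡×1 n)

  fromℕ-* : ∀ m n → fromℕ rawRing (m ℕ.* n) ≈ fromℕ rawRing m * fromℕ rawRing n
  fromℕ-* m n rewrite fromℕ≡×1 (m ℕ.* n) | fromℕ≡×1 m | fromℕ≡×1 n = ×1-homo-* m n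

  fromℕ-inverse : ∀ p m n j → IsFpAlgebra p R → m ℕ.* n ≡ suc (j ℕ.* p) →
                  fromℕ rawRing m * fromℕ rawRing n ≈ 1#
  fromℕ-inverse p m n j char mn≡1+jp = begin
    fromℕ rawRing m * fromℕ rawRing n       ≈⟨ fromℕ-* m n ⟨
    fromℕ rawRing (m ℕ.* n)                 ≡⟨ ≡.cong (fromℕ rawRing) mn≡1+jp ⟩
    1# + fromℕ rawRing (j ℕ.* p)            ≈⟨ +-congˡ (fromℕ-* j p) ⟩
    1# + fromℕ rawRing j * fromℕ rawRing p  ≈⟨ +-congˡ (*-congˡ char) ⟩
    1# + fromℕ rawRing j * 0#               ≈⟨ +-congˡ (zeroʳ _) ⟩
    1# + 0#                                 ≈⟨ +-identityʳ 1# ⟩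
    1#                                      ∎

StableRangeOne : CommutativeRing c ℓ → Set (c ⊔ ℓ)
StableRangeOne R = ∀ α β u v → α * u + β * v ≈ 1# → Σ[ y ∈ Carrier ] Invertible rawRing (α * y + β)
  where open CommutativeRing R

module _ (R : CommutativeRing c ℓ) where
  open CommutativeRing R
  open RingSolver R
  open import Relation.Binary.Reasoning.Setoid setoid

  IsLocal⇒StableRangeOne : IsLocal R → StableRangeOne R
  IsLocal⇒StableRangeOne (_ , local) α β u v αu+βv≈1
    with local (α * u) (β * v) (1# , trans (*-identityʳ _) αu+βv≈1)
  ... | inj₁ (z , αu·z≈1) = u * z * (1# - β) , 1# , (begin
    (α * (u * z * (1# - β)) + β) * 1#  ≈⟨ solve 4 (λ α β u z → (α :* (u :* z :* (:1 :- β)) :+ β) :* :1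
                                                  := α :* u :* z :* (:1 :- β) :+ β) refl α β u z ⟩
    α * u * z * (1# - β) + β           ≈⟨ +-congʳ (*-congʳ αu·z≈1) ⟩
    1# * (1# - β) + β                  ≈⟨ solve 1 (λ β → :1 :* (:1 :- β) :+ β := :1) refl β ⟩
    1#                                 ∎)
  ... | inj₂ (z , βv·z≈1) = 0# , v * z , (begin
    (α * 0# + β) * (v * z)  ≈⟨ solve 4 (λ α β v z → (α :* :0 :+ β) :* (v :* z) := β :* v :* z) refl α β v z ⟩
    β * v * z               ≈⟨ βv·z≈1 ⟩
    1#                      ∎)

∏-commutativeRing : (r : ℕ) → (Fin r → CommutativeRing c ℓ) → CommutativeRing c ℓ
∏-commutativeRing r A = record
  { RawRing (∏ r A)
  ; isCommutativeRing = record
    { isRing = record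
      { +-isAbelianGroup = record
        { isGroup = record
          { isMonoid = record
            { isSemigroup = record
              { isMagma = record
                { isEquivalence = record
                  { refl  = λ i → A.refl i
                  ; sym   = λ x≈y i → A.sym i (x≈y i)
                  ; trans = λ x≈y y≈z i → A.trans i (x≈y i) (y≈z i)
                  }
                ; ∙-cong = λ x≈y u≈v i → A.+-cong i (x≈y i) (u≈v i)
                }
              ; assoc = λ x y z i → A.+-assoc i (x i) (y i) (z i)
              }
            ; identity = (λ x i → A.+-identityˡ i (x i)) , (λ x i → A.+-identityʳ i (x i))
            }
          ; inverse = (λ x i → A.-‿inverseˡ i (x i)) , (λ x i → A.-‿inverseʳ i (x i))
          ; ⁻¹-cong = λ x≈y i → A.-‿cong i (x≈y i)
          }
        ; comm = λ x y i → A.+-comm i (x i) (y i)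
        }
      ; *-cong     = λ x≈y u≈v i → A.*-cong i (x≈y i) (u≈v i)
      ; *-assoc    = λ x y z i → A.*-assoc i (x i) (y i) (z i)
      ; *-identity = (λ x i → A.*-identityˡ i (x i)) , (λ x i → A.*-identityʳ i (x i))
      ; distrib    = (λ x y z i → A.distribˡ i (x i) (y i) (z i)) , (λ x y z i → A.distribʳ i (x i) (y i) (z i))
      }
    ; *-comm = λ x y i → A.*-comm i (x i) (y i)
    }
  }
  where module A i = CommutativeRing (A i)

module _ {r : ℕ} (A : Fin r → CommutativeRing c ℓ) where
  private module A i = CommutativeRing (A i)

  ∏-stableRangeOne : (∀ i → StableRangeOne (A i)) → StableRangeOne (∏-commutativeRing r A)
  ∏-stableRangeOne sr α β u v αu+βv≈1 =
    proj₁ ∘ yw , (λ i → proj₁ (proj₂ (yw i))) , (λ i → proj₂ (proj₂ (yw i)))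
    where yw = λ i → sr i (α i) (β i) (u i) (v i) (αu+βv≈1 i)

  fromℕ-∏ : ∀ n i → fromℕ (∏ r A) n i ≡ fromℕ (A.rawRing i) n
  fromℕ-∏ zero    i = ≡.refl
  fromℕ-∏ (suc n) i = ≡.cong (A._+_ i (A.1# i)) (fromℕ-∏ n i)

  ∏-isFpAlgebra : ∀ {p} → (∀ i → IsFpAlgebra p (A i)) → IsFpAlgebra p (∏-commutativeRing r A)
  ∏-isFpAlgebra {p} char i = A.trans i (A.reflexive i (fromℕ-∏ p i)) (char i)

module Matrices (S : RawRing c ℓ) where
  open RawRing S

  infixl 7 _·_
  _·_ : Mat2 S → Mat2 S → Mat2 S
  _·_ = _*M_ S

  infix 4 _≃_
  _≃_ : Mat2 S → Mat2 S → Set ℓ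
  _≃_ = _≈M_ S

  E₁₂ E₂₁ : Carrier → Mat2 S
  E₁₂ x = mat 1# x 0# 1#
  E₂₁ x = mat 1# 0# x 1#

  diag : Carrier → Carrier → Mat2 S
  diag s t = mat s 0# 0# t

-- Polynomials form a raw ring, so _*M_, adj and det apply to them symbolically;
-- proveM then checks a matrix identity entrywise by normalisation.
module MatrixSolver (R : CommutativeRing c ℓ) where
  open CommutativeRing R
  open RingSolver R public

  PolyRing : ℕ → RawRing _ _
  PolyRing n = record
    { Carrier = Polynomial n ; _≈_ = _≡_
    ; _+_ = _:+_ ; _*_ = _:*_ ; -_ = :-_ ; 0# = :0 ; 1# = :1 }

  ⟦_⟧M ⟦_⟧M↓ : ∀ {n} → Mat2 (PolyRing n) → Vec Carrier n → Mat2 rawRing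
  ⟦ P ⟧M  ρ = mat (⟦ a P ⟧ ρ) (⟦ b P ⟧ ρ) (⟦ c′ P ⟧ ρ) (⟦ d P ⟧ ρ)
  ⟦ P ⟧M↓ ρ = mat (⟦ a P ⟧↓ ρ) (⟦ b P ⟧↓ ρ) (⟦ c′ P ⟧↓ ρ) (⟦ d P ⟧↓ ρ)

  proveM : ∀ {n} (ρ : Vec Carrier n) (P Q : Mat2 (PolyRing n)) →
           _≈M_ rawRing (⟦ P ⟧M↓ ρ) (⟦ Q ⟧M↓ ρ) → _≈M_ rawRing (⟦ P ⟧M ρ) (⟦ Q ⟧M ρ)
  proveM ρ P Q ((a≈ , b≈) , (c≈ , d≈)) =
    (prove ρ (a P) (a Q) a≈ , prove ρ (b P) (b Q) b≈) ,
    (prove ρ (c′ P) (c′ Q) c≈ , prove ρ (d P) (d Q) d≈)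

module SL₂ (R : CommutativeRing c ℓ) where
  open CommutativeRing R
  open MatrixSolver R
  open Matrices rawRing
  module X {n} = Matrices (PolyRing n)
  open import Algebra.Properties.Ring ring using (-‿distribʳ-*)
  open import Relation.Binary.Reasoning.Setoid setoid

  ≃-refl : ∀ {M} → M ≃ M
  ≃-refl = (refl , refl) , (refl , refl)

  ≃-trans : ∀ {L M N} → L ≃ M → M ≃ N → L ≃ N
  ≃-trans ((a₁ , b₁) , (c₁ , d₁)) ((a₂ , b₂) , (c₂ , d₂)) =
    (trans a₁ a₂ , trans b₁ b₂) , (trans c₁ c₂ , trans d₁ d₂)

  det-· : ∀ M N → det rawRing (M · N) ≈ det rawRing M * det rawRing N
  det-· M N = prove (a M ∷ b M ∷ c′ M ∷ d M ∷ a N ∷ b N ∷ c′ N ∷ d N ∷ [])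
    (det (PolyRing 8) (M′ X.· N′)) (det (PolyRing 8) M′ :* det (PolyRing 8) N′) refl
    where
    M′ N′ : Mat2 (PolyRing 8)
    M′ = mat (var 0F) (var 1F) (var 2F) (var 3F)
    N′ = mat (var 4F) (var 5F) (var 6F) (var 7F)

  SL₂-· : ∀ {M N} → InSL2 rawRing M → InSL2 rawRing N → InSL2 rawRing (M · N)
  SL₂-· {M} {N} detM≈1 detN≈1 = begin
    det rawRing (M · N)              ≈⟨ det-· M N ⟩
    det rawRing M * det rawRing N    ≈⟨ *-cong detM≈1 detN≈1 ⟩
    1# * 1#                          ≈⟨ *-identityˡ 1# ⟩
    1#                               ∎

  SL₂-idM : InSL2 rawRing (idM rawRing)
  SL₂-idM = solve 0 (det (PolyRing 0) (idM (PolyRing 0)) := :1) refl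

  SL₂-E₁₂ : ∀ x → InSL2 rawRing (E₁₂ x)
  SL₂-E₁₂ = solve 1 (λ x → det (PolyRing 1) (X.E₁₂ x) := :1) refl

  SL₂-E₂₁ : ∀ x → InSL2 rawRing (E₂₁ x)
  SL₂-E₂₁ = solve 1 (λ x → det (PolyRing 1) (X.E₂₁ x) := :1) refl

  ·-E₁₂-E₂₁-cancel : ∀ M y x → M · E₁₂ y · E₂₁ x · E₂₁ (- x) · E₁₂ (- y) ≃ M
  ·-E₁₂-E₂₁-cancel M y x = proveM (a M ∷ b M ∷ c′ M ∷ d M ∷ y ∷ x ∷ [])
    (M′ X.· X.E₁₂ (var 4F) X.· X.E₂₁ (var 5F) X.· X.E₂₁ (:- var 5F) X.· X.E₁₂ (:- var 4F)) M′ ≃-refl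
    where
    M′ : Mat2 (PolyRing 6)
    M′ = mat (var 0F) (var 1F) (var 2F) (var 3F)

  a-·E₁₂-E₂₁≈1 : ∀ M y w → (a M * y + b M) * w ≈ 1# → a (M · E₁₂ y · E₂₁ (w * (1# - a M))) ≈ 1#
  a-·E₁₂-E₂₁≈1 M y w [αy+β]w≈1 = begin
    a (M · E₁₂ y · E₂₁ (w * (1# - α)))  ≈⟨ solve 4 (λ α β y w →
                                              a (mat α β :0 :0 X.· X.E₁₂ y X.· X.E₂₁ (w :* (:1 :- α)))
                                              := α :+ ((α :* y :+ β) :* w) :* (:1 :- α)) refl α (b M) y w ⟩
    α + ((α * y + b M) * w) * (1# - α)  ≈⟨ +-congˡ (*-congʳ [αy+β]w≈1) ⟩
    α + 1# * (1# - α)                   ≈⟨ solve 1 (λ α → α :+ :1 :* (:1 :- α) := :1) refl α ⟩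
    1#                                  ∎
    where α = a M

  E₂₁-E₁₂-factorisation : ∀ M → a M ≈ 1# → InSL2 rawRing M → E₂₁ (c′ M) · E₁₂ (b M) ≃ M
  E₂₁-E₁₂-factorisation (mat α β γ δ) α≈1 det≈1 = ≃-trans
    (proveM (β ∷ γ ∷ []) (X.E₂₁ (var 1F) X.· X.E₁₂ (var 0F))
                         (mat :1 (var 0F) (var 1F) (var 0F :* var 1F :+ :1)) ≃-refl)
    ((sym α≈1 , refl) , (refl , βγ+1≈δ))
    where
    βγ+1≈δ : β * γ + 1# ≈ δ
    βγ+1≈δ = begin
      β * γ + 1#                   ≈⟨ +-congˡ det≈1 ⟨
      β * γ + (α * δ + - (β * γ))  ≈⟨ solve 4 (λ α β γ δ → β :* γ :+ (α :* δ :+ :- (β :* γ)) := α :* δ)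
                                                refl α β γ δ ⟩
      α * δ                        ≈⟨ *-congʳ α≈1 ⟩
      1# * δ                       ≈⟨ *-identityˡ δ ⟩
      δ                            ∎

  module _ (sr : StableRangeOne R) {p} (P : Mat2 rawRing → Set p)
           (P-resp : ∀ {M N} → M ≃ N → P M → P N)
           (P-· : ∀ {M N} → P M → P N → P (M · N))
           (P-E₁₂ : ∀ x → P (E₁₂ x)) (P-E₂₁ : ∀ x → P (E₂₁ x)) where

    SL₂-elementary-induction : ∀ M → InSL2 rawRing M → P M
    SL₂-elementary-induction M det≈1
      with sr (a M) (b M) (d M) (- c′ M) (trans (+-congˡ (sym (-‿distribʳ-* (b M) (c′ M)))) det≈1)
    ... | y , w , [αy+β]w≈1 =
      P-resp (·-E₁₂-E₂₁-cancel M y x) (P-· (P-· P[M′] (P-E₂₁ (- x))) (P-E₁₂ (- y)))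
      where
      x = w * (1# - a M)
      M′ = M · E₁₂ y · E₂₁ x
      P[M′] : P M′
      P[M′] = P-resp
        (E₂₁-E₁₂-factorisation M′ (a-·E₁₂-E₂₁≈1 M y w [αy+β]w≈1)
          (SL₂-· (SL₂-· det≈1 (SL₂-E₁₂ y)) (SL₂-E₂₁ x)))
        (P-· (P-E₂₁ (c′ M′)) (P-E₁₂ (b M′)))

  idM-conj : ∀ D → idM rawRing · D · adj rawRing (idM rawRing) ≃ D
  idM-conj D = proveM (a D ∷ b D ∷ c′ D ∷ d D ∷ [])
    (idM (PolyRing 4) X.· D′ X.· adj (PolyRing 4) (idM (PolyRing 4))) D′ ≃-refl
    where
    D′ : Mat2 (PolyRing 4)
    D′ = mat (var 0F) (var 1F) (var 2F) (var 3F)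

  E₁₂-commutator : ∀ {s t} u → s * t ≈ 1# →
    E₁₂ (- u) · diag s t · adj rawRing (E₁₂ (- u)) · adj rawRing (diag s t) ≃ E₁₂ ((s * s - 1#) * u)
  E₁₂-commutator {s} {t} u st≈1 = ≃-trans
    (proveM (s ∷ t ∷ u ∷ [])
      (X.E₁₂ (:- u′) X.· X.diag s′ t′ X.· adj (PolyRing 3) (X.E₁₂ (:- u′)) X.· adj (PolyRing 3) (X.diag s′ t′))
      (mat (s′ :* t′) ((s′ :* s′ :- s′ :* t′) :* u′) :0 (s′ :* t′)) ≃-refl)
    ((st≈1 , *-congʳ (+-congˡ (-‿cong st≈1))) , (refl , st≈1))
    where
    s′ = var 0F
    t′ = var 1F
    u′ = var 2F

  E₂₁-commutator : ∀ {s t} u → s * t ≈ 1# →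
    adj rawRing (E₂₁ (- u) · diag s t · adj rawRing (E₂₁ (- u))) · diag s t ≃ E₂₁ ((s * s - 1#) * u)
  E₂₁-commutator {s} {t} u st≈1 = ≃-trans
    (proveM (s ∷ t ∷ u ∷ [])
      (adj (PolyRing 3) (X.E₂₁ (:- u′) X.· X.diag s′ t′ X.· adj (PolyRing 3) (X.E₂₁ (:- u′))) X.· X.diag s′ t′)
      (mat (s′ :* t′) :0 ((s′ :* s′ :- s′ :* t′) :* u′) (s′ :* t′)) ≃-refl)
    ((st≈1 , refl) , (*-congʳ (+-congˡ (-‿cong st≈1)) , st≈1))
    where
    s′ = var 0F
    t′ = var 1F
    u′ = var 2F

module _ (R : CommutativeRing c ℓ) (p : ℕ) where
  open CommutativeRing R
  open Matrices rawRing
  open SL₂ R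

  ι∈NormalClosure : ∀ g → NormalClosure rawRing p (ι rawRing p g)
  ι∈NormalClosure g = resp (idM-conj (ι rawRing p g)) (conj (idM rawRing) SL₂-idM g)

  module _ (g : SL2Fp p) {s t} (ιg≡diag : ι rawRing p g ≡ diag s t) (st≈1 : s * t ≈ 1#)
           {k} ([s²-1]k≈1 : (s * s - 1#) * k ≈ 1#) where

    [s²-1][kx]≈x : ∀ x → (s * s - 1#) * (k * x) ≈ x
    [s²-1][kx]≈x x = trans (sym (*-assoc _ k x)) (trans (*-congʳ [s²-1]k≈1) (*-identityˡ x))

    E₁₂∈NormalClosure : ∀ x → NormalClosure rawRing p (E₁₂ x)
    E₁₂∈NormalClosure x = resp
      (≃-trans (E₁₂-commutator u st≈1) ((refl , [s²-1][kx]≈x x) , (refl , refl)))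
      (≡.subst (λ D → NormalClosure rawRing p (E₁₂ (- u) · D · adj rawRing (E₁₂ (- u)) · adj rawRing D))
        ιg≡diag (mul (conj (E₁₂ (- u)) (SL₂-E₁₂ (- u)) g) (inv (ι∈NormalClosure g))))
      where u = k * x

    E₂₁∈NormalClosure : ∀ x → NormalClosure rawRing p (E₂₁ x)
    E₂₁∈NormalClosure x = resp
      (≃-trans (E₂₁-commutator u st≈1) ((refl , refl) , ([s²-1][kx]≈x x , refl)))
      (≡.subst (λ D → NormalClosure rawRing p (adj rawRing (E₂₁ (- u) · D · adj rawRing (E₂₁ (- u))) · D))
        ιg≡diag (mul (inv (conj (E₂₁ (- u)) (SL₂-E₂₁ (- u)) g)) (ι∈NormalClosure g)))
      where u = k * x

diag-2 : ∀ {q} (t : Fin (3 ℕ.+ q)) → 2 ℕ.* toℕ t ≡ suc (3 ℕ.+ q) → SL2Fp (3 ℕ.+ q)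
-- the determinant condition becomes p ∣ (1 + p) - 1, which computes to p ∣ p
diag-2 {q} t 2t≡1+p = mkSL2Fp 2F 0F 0F t
  (≡.subst (λ m → ℤ.+ (3 ℕ.+ q) ∣ℤ (ℤ.+ m ℤ.- ℤ.+ 1)) (≡.sym 2t≡1+p) ∣-refl)

module _ (R : CommutativeRing c ℓ) where
  open CommutativeRing R
  open SL₂ R
  open RingSolver R

  SL₂⊆NormalClosure : StableRangeOne R → ∀ p → Prime p → 5 ≤ p → IsFpAlgebra p R →
                      ∀ M → InSL2 rawRing M → NormalClosure rawRing p M
  SL₂⊆NormalClosure sr .(3 ℕ.+ q) pr (ℕ.s≤s (ℕ.s≤s (ℕ.s≤s {n = q} 2≤q))) char
    with 2⁻¹-mod-prime pr (ℕ.s≤s (ℕ.s≤s (ℕ.s≤s ℕ.z≤n)))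
       | 3⁻¹-mod-prime pr (ℕ.s≤s (ℕ.s≤s (ℕ.s≤s (ℕ.<⇒≤ 2≤q))))
  ... | t , 2t≡1+p | k , j , 3k≡1+jp =
    SL₂-elementary-induction sr (NormalClosure rawRing p) resp mul
      (E₁₂∈NormalClosure R p g ≡.refl st≈1 [s²-1]k≈1)
      (E₂₁∈NormalClosure R p g ≡.refl st≈1 [s²-1]k≈1)
    where
    p = 3 ℕ.+ q
    g = diag-2 t 2t≡1+p
    st≈1 : fromℕ rawRing 2 * fromℕ rawRing (toℕ t) ≈ 1#
    st≈1 = fromℕ-inverse R p 2 (toℕ t) 1 char (≡.trans 2t≡1+p (≡.cong suc (≡.sym (ℕ.*-identityˡ p))))
    [s²-1]k≈1 : (fromℕ rawRing 2 * fromℕ rawRing 2 - 1#) * fromℕ rawRing k ≈ 1#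
    [s²-1]k≈1 = trans
      -- 2 · 2 - 1 ≈ 3, with the numerals unfolded as fromℕ computes them
      (*-congʳ (solve 0 ((:1 :+ (:1 :+ :0)) :* (:1 :+ (:1 :+ :0)) :- :1 := :1 :+ (:1 :+ (:1 :+ :0))) refl))
      (fromℕ-inverse R p 3 k j char 3k≡1+jp)

lemmaA1p3 : ∀ {c ℓ : Level} (p : ℕ) → Prime p → 5 ≤ p →
    (r : ℕ) (A : Fin r → CommutativeRing c ℓ) →
    (∀ i → IsLocal (A i)) → (∀ i → IsFpAlgebra p (A i)) →
    (M : Mat2 (∏ r A)) → InSL2 (∏ r A) M → NormalClosure (∏ r A) p M
lemmaA1p3 p pr 5≤p r A local char =
  SL₂⊆NormalClosure (∏-commutativeRing r A)
    (∏-stableRangeOne A (λ i → IsLocal⇒StableRangeOne (A i) (local i)))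
    p pr 5≤p (∏-isFpAlgebra A {p} char)
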